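{- Let $b$ be a rational number with $b\neq 1$ and let $c=2$. Then the cubic polynomials $P(x)$ and $Q(d)$ (defined in the context) are reducible over $\mathbb{Q}$. Moreover, if $b=\frac{2t}{(t+2)^2-2}$ for some rational $t$, then each of $P$ and $Q$ has three rational roots (counted with multiplicity), these roots can be labelled $x_1,x_2,x_3$ (roots of $P$) and $d_1,d_2,d_3$ (roots of $Q$) so that the auxiliary equations hold, but these six numbers are not all positive, so they do not provide a solution of the perfect cuboid problem (Problem 1.2).
   Context: Let $b,c$ be rational numbers. Put $\Delta=b^2c^4-6b^2c^3+13b^2c^2-12b^2c+4b^2+c^2$ and $N=(bc-1-b)(bc-c-2b)$, and assume $\Delta\,N\neq 0$, so that all the following rational numbers are defined (with $D=b^2c^2+2b^2-3b^2c+c-bc^2+2b$): $E_{11}=-\frac{b(c^2+2-4c)}{D}$, $E_{01}=-\frac{b(c^2+2-2c)}{D}$, $E_{10}=-\frac{b^2c^2+2b^2-3b^2c-c}{D}$; $E_{20}=\frac{b}{2}(bc^2-2c-2b)(2bc^2-c^2-6bc+2+4b)(bc-1-b)^{ -2}(bc-c-2b)^{ -2}$; $E_{02}=\frac12(28b^2c^2-16b^2c-2c^2-4b^2-b^2c^4+4b^3c^4-12b^3c^3+4bc^3+24b^3c-8bc-2b^4c^4+12b^4c^3-26b^4c^2-8b^2c^3+24b^4c-16b^3-8b^4)(bc-1-b)^{ -2}(bc-c-2b)^{ -2}$; $E_{21}=\frac{b}{2}(5c^6b-2c^6b^2+52c^5b^2-16c^5b-2c^7b^2+2b^4c^8+142b^4c^6-26b^4c^7-426b^4c^5-61b^3c^6+100b^3c^5+14c^7b^3-c^8b^3-20bc^2-8b^2c^2-16b^2c-128b^2c^4-200b^3c^3+244b^3c^2+32bc^3-112b^3c+768b^4c^4-852b^4c^3+568b^4c^2+104b^2c^3-208b^4c+8c^4-4c^3+16b^3+32b^4-2c^5)\,\Delta^{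 -1}(bc-1-b)^{ -2}(bc-c-2b)^{ -2}$; $E_{12}=(16b^6+32b^5-6c^5b^2+2c^5b-62b^5c^6+62b^6c^6-180b^6c^5+18b^5c^7-12b^6c^7-2b^5c^8+b^6c^8+248b^5c^2+248b^6c^2-96b^6c+321b^6c^4-180b^5c^3-144b^5c-360b^6c^3+b^4c^8+8b^4c^6-6b^4c^7+18b^4c^5+7b^3c^6+90b^5c^5-14b^3c^5-c^7b^3+17b^2c^4+28b^3c^3-28b^3c^2-4bc^3+8b^3c-57b^4c^4+36b^4c^3+32b^4c^2-12b^2c^3-48b^4c-c^4+16b^4)\,\Delta^{ -1}(bc-1-b)^{ -2}(bc-c-2b)^{ -2}$; $E_{03}=\frac{b}{2}(b^2c^4-5b^2c^3+10b^2c^2-10b^2c+4b^2+2bc+2c^2-bc^3)(2b^2c^4-12b^2c^3+26b^2c^2-24b^2c+8b^2-c^4b+3bc^3-6bc+4b+c^3-2c^2+2c)\,\Delta^{ -1}(bc-1-b)^{ -2}(bc-c-2b)^{ -2}$; $E_{30}=c\,b^2(1-c)(c-2)(bc^2-4bc+2+4b)(2bc^2-c^2-4bc+2b)\,\Delta^{ -1}(bc-1-b)^{ -2}(bc-c-2b)^{ -2}$. Define $P(x)=x^3-E_{10}x^2+E_{20}x-E_{30}$ and $Q(d)=d^3-E_{01}d^2+E_{02}d-E_{03}$. For numbers $x_1,x_2,x_3,d_1,d_2,d_3$ the auxiliary equations are: $x_1x_2d_3+x_2x_3d_1+x_3x_1d_2=E_{21}$, $x_1d_2+d_1x_2+x_2d_3+d_2x_3+x_3d_1+d_3x_1=E_{11}$,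 $x_1d_2d_3+x_2d_3d_1+x_3d_1d_2=E_{12}$. Problem 1.2 (equivalent to finding a perfect cuboid) asks for rational $b,c$ such that $P$ and $Q$ have positive rational roots $x_1,x_2,x_3$ and $d_1,d_2,d_3$ satisfying the auxiliary equations. -}

module Defs where

open import Data.Nat.Base as ℕ using (ℕ; zero; suc)
open import Data.List.Base using (List; []; _∷_; map)
open import Data.Product.Base using (Σ; ∃; _×_; _,_)
open import Relation.Binary.PropositionalEquality using (_≡_; _≢_)
open import Relation.Nullary using (yes; no)
open import Data.Rational.Base
  using (ℚ; 0ℚ; 1ℚ; _+_; _*_; _-_; -_; 1/_; ≢-nonZero)
open import Data.Rational.Properties using (_≟_)
import Data.Rational.Literals as Lit
import Data.Nat.Literals as NLit

open import Agda.Builtin.FromNat using (Number; fromNat)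
open import Agda.Builtin.FromNeg using (Negative; fromNeg)
open import Data.Unit.Base using (⊤; tt)

instance
  ℚ-number : Number ℚ
  ℚ-number = Lit.number
  ℕ-number : Number ℕ
  ℕ-number = NLit.number
  ℚ-negative : Negative ℚ
  ℚ-negative = Lit.negative

infixr 8 _^_
_^_ : ℚ → ℕ → ℚ
p ^ zero = 1ℚ
p ^ suc n = p * (p ^ n)

-- Total inverse: inv 0 = 0 (only ever applied to nonzero arguments
-- under the hypotheses of the theorem).
inv : ℚ → ℚ
inv p with p ≟ 0ℚ
... | yes _ = 0ℚ
... | no p≢0 = 1/_ p {{≢-nonZero p≢0}}

Δ : ℚ → ℚ → ℚ
Δ b c = b ^ 2 * c ^ 4 - 6 * b ^ 2 * c ^ 3 + 13 * b ^ 2 * c ^ 2 - 12 * b ^ 2 * c + 4 * b ^ 2 + c ^ 2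

N : ℚ → ℚ → ℚ
N b c = (b * c - 1 - b) * (b * c - c - 2 * b)

D : ℚ → ℚ → ℚ
D b c = b ^ 2 * c ^ 2 + 2 * b ^ 2 - 3 * b ^ 2 * c + c - b * c ^ 2 + 2 * b

W : ℚ → ℚ → ℚ
W b c = inv ((b * c - 1 - b) ^ 2) * inv ((b * c - c - 2 * b) ^ 2)

half : ℚ
half = inv 2

E11 : ℚ → ℚ → ℚ
E11 b c = - (b * (c ^ 2 + 2 - 4 * c)) * inv (D b c)

E01 : ℚ → ℚ → ℚ
E01 b c = - (b * (c ^ 2 + 2 - 2 * c)) * inv (D b c)

E10 : ℚ → ℚ → ℚ
E10 b c = - (b ^ 2 * c ^ 2 + 2 * b ^ 2 - 3 * b ^ 2 * c - c) * inv (D b c)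

E20 : ℚ → ℚ → ℚ
E20 b c = half * b * (b * c ^ 2 - 2 * c - 2 * b)
  * (2 * b * c ^ 2 - c ^ 2 - 6 * b * c + 2 + 4 * b) * W b c

E02 : ℚ → ℚ → ℚ
E02 b c = half
  * (28 * b ^ 2 * c ^ 2 - 16 * b ^ 2 * c - 2 * c ^ 2 - 4 * b ^ 2 - b ^ 2 * c ^ 4
     + 4 * b ^ 3 * c ^ 4 - 12 * b ^ 3 * c ^ 3 + 4 * b * c ^ 3 + 24 * b ^ 3 * c
     - 8 * b * c - 2 * b ^ 4 * c ^ 4 + 12 * b ^ 4 * c ^ 3 - 26 * b ^ 4 * c ^ 2
     - 8 * b ^ 2 * c ^ 3 + 24 * b ^ 4 * c - 16 * b ^ 3 - 8 * b ^ 4)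
  * W b c

E21 : ℚ → ℚ → ℚ
E21 b c = half * b
  * (5 * c ^ 6 * b - 2 * c ^ 6 * b ^ 2 + 52 * c ^ 5 * b ^ 2 - 16 * c ^ 5 * b
     - 2 * c ^ 7 * b ^ 2 + 2 * b ^ 4 * c ^ 8 + 142 * b ^ 4 * c ^ 6
     - 26 * b ^ 4 * c ^ 7 - 426 * b ^ 4 * c ^ 5 - 61 * b ^ 3 * c ^ 6
     + 100 * b ^ 3 * c ^ 5 + 14 * c ^ 7 * b ^ 3 - c ^ 8 * b ^ 3 - 20 * b * c ^ 2
     - 8 * b ^ 2 * c ^ 2 - 16 * b ^ 2 * c - 128 * b ^ 2 * c ^ 4
     - 200 * b ^ 3 * c ^ 3 + 244 * b ^ 3 * c ^ 2 + 32 * b * c ^ 3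
     - 112 * b ^ 3 * c + 768 * b ^ 4 * c ^ 4 - 852 * b ^ 4 * c ^ 3
     + 568 * b ^ 4 * c ^ 2 + 104 * b ^ 2 * c ^ 3 - 208 * b ^ 4 * c + 8 * c ^ 4
     - 4 * c ^ 3 + 16 * b ^ 3 + 32 * b ^ 4 - 2 * c ^ 5)
  * inv (Δ b c) * W b c

E12 : ℚ → ℚ → ℚ
E12 b c =
    (16 * b ^ 6 + 32 * b ^ 5 - 6 * c ^ 5 * b ^ 2 + 2 * c ^ 5 * b
     - 62 * b ^ 5 * c ^ 6 + 62 * b ^ 6 * c ^ 6 - 180 * b ^ 6 * c ^ 5
     + 18 * b ^ 5 * c ^ 7 - 12 * b ^ 6 * c ^ 7 - 2 * b ^ 5 * c ^ 8
     + b ^ 6 * c ^ 8 + 248 * b ^ 5 * c ^ 2 + 248 * b ^ 6 * c ^ 2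
     - 96 * b ^ 6 * c + 321 * b ^ 6 * c ^ 4 - 180 * b ^ 5 * c ^ 3
     - 144 * b ^ 5 * c - 360 * b ^ 6 * c ^ 3 + b ^ 4 * c ^ 8
     + 8 * b ^ 4 * c ^ 6 - 6 * b ^ 4 * c ^ 7 + 18 * b ^ 4 * c ^ 5
     + 7 * b ^ 3 * c ^ 6 + 90 * b ^ 5 * c ^ 5 - 14 * b ^ 3 * c ^ 5
     - c ^ 7 * b ^ 3 + 17 * b ^ 2 * c ^ 4 + 28 * b ^ 3 * c ^ 3
     - 28 * b ^ 3 * c ^ 2 - 4 * b * c ^ 3 + 8 * b ^ 3 * c
     - 57 * b ^ 4 * c ^ 4 + 36 * b ^ 4 * c ^ 3 + 32 * b ^ 4 * c ^ 2
     - 12 * b ^ 2 * c ^ 3 - 48 * b ^ 4 * c - c ^ 4 + 16 * b ^ 4)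
  * inv (Δ b c) * W b c

E03 : ℚ → ℚ → ℚ
E03 b c = half * b
  * (b ^ 2 * c ^ 4 - 5 * b ^ 2 * c ^ 3 + 10 * b ^ 2 * c ^ 2 - 10 * b ^ 2 * c
     + 4 * b ^ 2 + 2 * b * c + 2 * c ^ 2 - b * c ^ 3)
  * (2 * b ^ 2 * c ^ 4 - 12 * b ^ 2 * c ^ 3 + 26 * b ^ 2 * c ^ 2
     - 24 * b ^ 2 * c + 8 * b ^ 2 - c ^ 4 * b + 3 * b * c ^ 3 - 6 * b * c
     + 4 * b + c ^ 3 - 2 * c ^ 2 + 2 * c)
  * inv (Δ b c) * W b c

E30 : ℚ → ℚ → ℚ
E30 b c = c * b ^ 2 * (1 - c) * (c - 2) * (b * c ^ 2 - 4 * b * c + 2 + 4 * b)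
  * (2 * b * c ^ 2 - c ^ 2 - 4 * b * c + 2 * b)
  * inv (Δ b c) * W b c

-- Univariate polynomials over ℚ as coefficient lists (lowest degree
-- first; trailing zeros allowed).

Poly : Set
Poly = List ℚ

coeff : Poly → ℕ → ℚ
coeff []       _       = 0ℚ
coeff (a ∷ p)  zero    = a
coeff (a ∷ p)  (suc i) = coeff p i

_+ₚ_ : Poly → Poly → Poly
[]      +ₚ q       = q
(a ∷ p) +ₚ []      = a ∷ p
(a ∷ p) +ₚ (b ∷ q) = (a + b) ∷ (p +ₚ q)

_*ₚ_ : Poly → Poly → Poly
[]      *ₚ q = []
(a ∷ p) *ₚ q = map (a *_) q +ₚ (0ℚ ∷ (p *ₚ q))

_≈ₚ_ : Poly → Poly → Set
p ≈ₚ q = ∀ i → coeff p i ≡ coeff q i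

NonConstant : Poly → Set
NonConstant p = ∃ λ i → coeff p (suc i) ≢ 0ℚ

Reducible : Poly → Set
Reducible p = Σ Poly λ f → Σ Poly λ g →
  NonConstant f × NonConstant g × (p ≈ₚ (f *ₚ g))

X-_ : ℚ → Poly
X- r = (- r) ∷ 1ℚ ∷ []

P : ℚ → ℚ → Poly
P b c = (- E30 b c) ∷ E20 b c ∷ (- E10 b c) ∷ 1ℚ ∷ []

Q : ℚ → ℚ → Poly
Q b c = (- E03 b c) ∷ E02 b c ∷ (- E01 b c) ∷ 1ℚ ∷ []

Auxiliary : ℚ → ℚ → (x₁ x₂ x₃ d₁ d₂ d₃ : ℚ) → Set
Auxiliary b c x₁ x₂ x₃ d₁ d₂ d₃ =
    (x₁ * x₂ * d₃ + x₂ * x₃ * d₁ + x₃ * x₁ * d₂ ≡ E21 b c)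
  × (x₁ * d₂ + d₁ * x₂ + x₂ * d₃ + d₂ * x₃ + x₃ * d₁ + d₃ * x₁ ≡ E11 b c)
  × (x₁ * d₂ * d₃ + x₂ * d₃ * d₁ + x₃ * d₁ * d₂ ≡ E12 b c)

-- At c = 2 the factor c - 2 of E30 vanishes, Δ = 4, D = 2 (1 - b) and
-- (bc - 1 - b)(bc - c - 2b) = -2 (b - 1), so with u = 1/(b - 1) every E_ij is a
-- polynomial in u, and with m = (u² - 1)/2
--   P(x) = x (x² + u x + m),   Q(d) = (d - 1)(d² - u d + m).
-- Both quadratics have discriminant 2 - u² = u² (2 (b - 1)² - 1), and
-- b = 2t/((t + 2)² - 2), r = (t² - 2)/((t + 2)² - 2) parametrises the conic
-- r² = 2 (b - 1)² - 1, so then all six roots are rational.  They satisfy the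
-- auxiliary equations, but the root x₁ = 0 of P is not positive.
module Submission where

open import Defs
open import Agda.Builtin.FromNat using (fromNat)
open import Data.Unit.Base using (tt)
open import Data.Product.Base using (Σ; ∃; _×_; _,_)
open import Relation.Binary.PropositionalEquality using (_≡_; _≢_)
open import Relation.Nullary using (¬_)
open import Data.Rational.Base using (ℚ; 0ℚ; 1ℚ; _+_; _*_; _-_; _<_)

open import Data.Empty using (⊥-elim)
open import Data.List.Base using ([]; _∷_; map)
open import Data.Nat.Base using (zero; suc)
open import Data.Rational.Base using (-_; 1/_; ≢-nonZero)
open import Data.Rational.Properties
  using (_≟_; +-0-group; +-*-commutativeRing; +-identityˡ; +-identityʳ;
         *-zeroˡ; *-zeroʳ; *-identityˡ; *-identityʳ; *-assoc; 1≢0;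
         *-inverseˡ; *-inverseʳ; <-irrefl)
open import Algebra.Properties.Group +-0-group
  using (x∙y⁻¹≈ε⇒x≈y; x≈y⇒x∙y⁻¹≈ε; ⁻¹-involutive)
open import Function.Base using (_∘_)
open import Relation.Binary.Bundles using (Setoid)
import Relation.Binary.Reasoning.Setoid
open import Relation.Binary.PropositionalEquality
  using (refl; sym; trans; cong; cong₂; module ≡-Reasoning)
open import Relation.Nullary using (Dec; yes; no)
open import Relation.Nullary.Decidable.Core using (dec⇒maybe)
open import Tactic.RingSolver using (solve; solve-∀)
open import Tactic.RingSolver.Core.AlmostCommutativeRing
  using (AlmostCommutativeRing; fromCommutativeRing)

ℚ-ring : AlmostCommutativeRing _ _
ℚ-ring = fromCommutativeRing +-*-commutativeRing (λ x → dec⇒maybe (0ℚ ≟ x))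

≡-mod : ∀ {L R x y} → x ≡ y → ∀ K → L ≡ R + (x - y) * K → L ≡ R
≡-mod {L} {R} {x} {y} x≡y K L≡R+[x-y]K = begin
  L                ≡⟨ L≡R+[x-y]K ⟩
  R + (x - y) * K  ≡⟨ cong (λ g → R + g * K) (x≈y⇒x∙y⁻¹≈ε x≡y) ⟩
  R + 0ℚ * K       ≡⟨ cong (R +_) (*-zeroˡ K) ⟩
  R + 0ℚ           ≡⟨ +-identityʳ R ⟩
  R                ∎
  where open ≡-Reasoning

inv-unique : ∀ x {y} → x * y ≡ 1ℚ → inv x ≡ y
inv-unique x {y} xy≡1 with x ≟ 0ℚ
... | yes refl = ⊥-elim (1≢0 (trans (sym xy≡1) (*-zeroˡ y)))
... | no x≢0 = begin
  1/ x            ≡⟨ sym (*-identityʳ (1/ x)) ⟩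
  1/ x * 1ℚ       ≡⟨ cong (1/ x *_) (sym xy≡1) ⟩
  1/ x * (x * y)  ≡⟨ sym (*-assoc (1/ x) x y) ⟩
  1/ x * x * y    ≡⟨ cong (_* y) (*-inverseˡ x) ⟩
  1ℚ * y          ≡⟨ *-identityˡ y ⟩
  y               ∎
  where
  open ≡-Reasoning
  instance _ = ≢-nonZero x≢0

inv-inverseʳ : ∀ {x} → x ≢ 0ℚ → x * inv x ≡ 1ℚ
inv-inverseʳ {x} x≢0 with x ≟ 0ℚ
... | yes x≡0 = ⊥-elim (x≢0 x≡0)
... | no x≢0′ = *-inverseʳ x
  where instance _ = ≢-nonZero x≢0′

inv-0 : ∀ {x} → x ≡ 0ℚ → inv x ≡ 0ℚ
inv-0 refl = refl

≈ₚ-setoid : Setoid _ _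
≈ₚ-setoid = record
  { Carrier       = Poly
  ; _≈_           = _≈ₚ_
  ; isEquivalence = record
    { refl  = λ _ → refl
    ; sym   = λ p≈q i → sym (p≈q i)
    ; trans = λ p≈q q≈r i → trans (p≈q i) (q≈r i)
    }
  }

module ≈ₚ-Reasoning = Relation.Binary.Reasoning.Setoid ≈ₚ-setoid

∷-congₚ : ∀ {a b p q} → a ≡ b → p ≈ₚ q → (a ∷ p) ≈ₚ (b ∷ q)
∷-congₚ a≡b p≈q zero    = a≡b
∷-congₚ a≡b p≈q (suc i) = p≈q i

coeff-+ₚ : ∀ p q i → coeff (p +ₚ q) i ≡ coeff p i + coeff q i
coeff-+ₚ []      q       i       = sym (+-identityˡ (coeff q i))
coeff-+ₚ (a ∷ p) []      i       = sym (+-identityʳ (coeff (a ∷ p) i))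
coeff-+ₚ (a ∷ p) (b ∷ q) zero    = refl
coeff-+ₚ (a ∷ p) (b ∷ q) (suc i) = coeff-+ₚ p q i

coeff-map-* : ∀ a p i → coeff (map (a *_) p) i ≡ a * coeff p i
coeff-map-* a []      i       = sym (*-zeroʳ a)
coeff-map-* a (x ∷ p) zero    = refl
coeff-map-* a (x ∷ p) (suc i) = coeff-map-* a p i

coeff-∷*ₚ : ∀ a p q i → coeff ((a ∷ p) *ₚ q) i ≡ a * coeff q i + coeff (0ℚ ∷ (p *ₚ q)) i
coeff-∷*ₚ a p q i =
  trans (coeff-+ₚ (map (a *_) q) _ i) (cong (_+ _) (coeff-map-* a q i))

*ₚ-congˡ : ∀ p q q′ → q ≈ₚ q′ → (p *ₚ q) ≈ₚ (p *ₚ q′)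
*ₚ-congˡ []      q q′ q≈q′ i = refl
*ₚ-congˡ (a ∷ p) q q′ q≈q′ i = begin
  coeff ((a ∷ p) *ₚ q) i
    ≡⟨ coeff-∷*ₚ a p q i ⟩
  a * coeff q i + coeff (0ℚ ∷ (p *ₚ q)) i
    ≡⟨ cong₂ _+_ (cong (a *_) (q≈q′ i)) (∷-congₚ refl (*ₚ-congˡ p q q′ q≈q′) i) ⟩
  a * coeff q′ i + coeff (0ℚ ∷ (p *ₚ q′)) i
    ≡⟨ coeff-∷*ₚ a p q′ i ⟨
  coeff ((a ∷ p) *ₚ q′) i
    ∎
  where open ≡-Reasoning

X-*ₚ-monicQuadratic : ∀ r q₀ q₁ →
  ((X- r) *ₚ (q₀ ∷ q₁ ∷ 1ℚ ∷ [])) ≈ₚ (- (r * q₀) ∷ q₀ - r * q₁ ∷ q₁ - r ∷ 1ℚ ∷ [])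
X-*ₚ-monicQuadratic r q₀ q₁ = ∷-congₚ c₀ (∷-congₚ c₁ (∷-congₚ c₂ λ _ → refl))
  where
  c₀ : - r * q₀ + 0ℚ ≡ - (r * q₀)
  c₀ = solve (r ∷ q₀ ∷ []) ℚ-ring
  c₁ : - r * q₁ + (1ℚ * q₀ + 0ℚ) ≡ q₀ - r * q₁
  c₁ = solve (r ∷ q₀ ∷ q₁ ∷ []) ℚ-ring
  c₂ : - r * 1ℚ + 1ℚ * q₁ ≡ q₁ - r
  c₂ = solve (r ∷ q₁ ∷ []) ℚ-ring

vieta₂ : ∀ x y → ((X- x) *ₚ (X- y)) ≈ₚ (x * y ∷ - (x + y) ∷ 1ℚ ∷ [])
vieta₂ x y = ∷-congₚ c₀ (∷-congₚ c₁ λ _ → refl)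
  where
  c₀ : - x * - y + 0ℚ ≡ x * y
  c₀ = solve (x ∷ y ∷ []) ℚ-ring
  c₁ : - x * 1ℚ + (1ℚ * - y + 0ℚ) ≡ - (x + y)
  c₁ = solve (x ∷ y ∷ []) ℚ-ring

quadratic-formula : ∀ σ q s → s * s ≡ σ * σ - 4 * q →
  ((X- (half * (σ + s))) *ₚ (X- (half * (σ - s)))) ≈ₚ (q ∷ - σ ∷ 1ℚ ∷ [])
quadratic-formula σ q s s² = begin
  (X- (half * (σ + s))) *ₚ (X- (half * (σ - s)))
    ≈⟨ vieta₂ (half * (σ + s)) (half * (σ - s)) ⟩
  (half * (σ + s) * (half * (σ - s)) ∷ - (half * (σ + s) + half * (σ - s)) ∷ 1ℚ ∷ [])
    ≈⟨ ∷-congₚ product (∷-congₚ sum λ _ → refl) ⟩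
  (q ∷ - σ ∷ 1ℚ ∷ [])
    ∎
  where
  open ≈ₚ-Reasoning
  product : half * (σ + s) * (half * (σ - s)) ≡ q
  product = ≡-mod s² (- (half * half)) (solve (σ ∷ q ∷ s ∷ []) ℚ-ring)
  sum : - (half * (σ + s) + half * (σ - s)) ≡ - σ
  sum = solve (σ ∷ s ∷ []) ℚ-ring

-- From here on powers x ^ k of Defs are written out as x * (… * 1ℚ): definitionally
-- the same, but visible to the ring solver, which does not unfold _^_.
Δ-at-2 : ∀ b → Δ b 2 ≡ 4
Δ-at-2 = unfolded
  where
  unfolded : ∀ b → let b² = b * (b * 1ℚ) in
    b² * 2 ^ 4 - 6 * b² * 2 ^ 3 + 13 * b² * 2 ^ 2 - 12 * b² * 2 + 4 * b² + 2 ^ 2 ≡ 4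
  unfolded = solve-∀ ℚ-ring

D-at-2 : ∀ b → D b 2 ≡ - 2 * (b - 1)
D-at-2 = unfolded
  where
  unfolded : ∀ b → let b² = b * (b * 1ℚ) in
    b² * 2 ^ 2 + 2 * b² - 3 * b² * 2 + 2 - b * 2 ^ 2 + 2 * b ≡ - 2 * (b - 1)
  unfolded = solve-∀ ℚ-ring

[bc-1-b]²-at-2 : ∀ b → (b * 2 - 1 - b) ^ 2 ≡ (b - 1) * (b - 1)
[bc-1-b]²-at-2 = unfolded
  where
  unfolded : ∀ b → let x = b * 2 - 1 - b in x * (x * 1ℚ) ≡ (b - 1) * (b - 1)
  unfolded = solve-∀ ℚ-ring

[bc-c-2b]²-at-2 : ∀ b → (b * 2 - 2 - 2 * b) ^ 2 ≡ 4
[bc-c-2b]²-at-2 = unfolded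
  where
  unfolded : ∀ b → let x = b * 2 - 2 - 2 * b in x * (x * 1ℚ) ≡ 4
  unfolded = solve-∀ ℚ-ring

E10-numerator-at-2 : ∀ b → let b² = b * (b * 1ℚ) in
  - (b² * 2 ^ 2 + 2 * b² - 3 * b² * 2 - 2) ≡ 2
E10-numerator-at-2 = solve-∀ ℚ-ring

E20-numerator-at-2 : ∀ b →
  half * b * (b * 2 ^ 2 - 2 * 2 - 2 * b) * (2 * b * 2 ^ 2 - 2 ^ 2 - 6 * b * 2 + 2 + 4 * b)
  ≡ 2 * (1 - (b - 1) * (b - 1))
E20-numerator-at-2 = solve-∀ ℚ-ring

E30-numerator-at-2 : ∀ b → let b² = b * (b * 1ℚ) in
  2 * b² * (1 - 2) * (2 - 2) * (b * 2 ^ 2 - 4 * b * 2 + 2 + 4 * b)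
  * (2 * b * 2 ^ 2 - 2 ^ 2 - 4 * b * 2 + 2 * b) ≡ 0ℚ
E30-numerator-at-2 = solve-∀ ℚ-ring

E02-numerator-at-2 : ∀ b → let b² = b * (b * 1ℚ); b³ = b * b²; b⁴ = b * b³ in
  half
  * (28 * b² * 2 ^ 2 - 16 * b² * 2 - 2 * 2 ^ 2 - 4 * b² - b² * 2 ^ 4
     + 4 * b³ * 2 ^ 4 - 12 * b³ * 2 ^ 3 + 4 * b * 2 ^ 3 + 24 * b³ * 2
     - 8 * b * 2 - 2 * b⁴ * 2 ^ 4 + 12 * b⁴ * 2 ^ 3 - 26 * b⁴ * 2 ^ 2
     - 8 * b² * 2 ^ 3 + 24 * b⁴ * 2 - 16 * b³ - 8 * b⁴)
  ≡ 2 * (1 + 2 * (b - 1) - (b - 1) * (b - 1))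
E02-numerator-at-2 = solve-∀ ℚ-ring

E03-numerator-at-2 : ∀ b → let b² = b * (b * 1ℚ) in
  half * b
  * (b² * 2 ^ 4 - 5 * b² * 2 ^ 3 + 10 * b² * 2 ^ 2 - 10 * b² * 2
     + 4 * b² + 2 * b * 2 + 2 * 2 ^ 2 - b * 2 ^ 3)
  * (2 * b² * 2 ^ 4 - 12 * b² * 2 ^ 3 + 26 * b² * 2 ^ 2
     - 24 * b² * 2 + 8 * b² - 2 ^ 4 * b + 3 * b * 2 ^ 3 - 6 * b * 2
     + 4 * b + 2 ^ 3 - 2 * 2 ^ 2 + 2 * 2)
  ≡ 8 * (1 - (b - 1) * (b - 1))
E03-numerator-at-2 = solve-∀ ℚ-ring

E12-numerator-at-2 : ∀ b →
  let b² = b * (b * 1ℚ); b³ = b * b²; b⁴ = b * b³; b⁵ = b * b⁴; b⁶ = b * b⁵ in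
    (16 * b⁶ + 32 * b⁵ - 6 * 2 ^ 5 * b² + 2 * 2 ^ 5 * b
     - 62 * b⁵ * 2 ^ 6 + 62 * b⁶ * 2 ^ 6 - 180 * b⁶ * 2 ^ 5
     + 18 * b⁵ * 2 ^ 7 - 12 * b⁶ * 2 ^ 7 - 2 * b⁵ * 2 ^ 8
     + b⁶ * 2 ^ 8 + 248 * b⁵ * 2 ^ 2 + 248 * b⁶ * 2 ^ 2
     - 96 * b⁶ * 2 + 321 * b⁶ * 2 ^ 4 - 180 * b⁵ * 2 ^ 3
     - 144 * b⁵ * 2 - 360 * b⁶ * 2 ^ 3 + b⁴ * 2 ^ 8
     + 8 * b⁴ * 2 ^ 6 - 6 * b⁴ * 2 ^ 7 + 18 * b⁴ * 2 ^ 5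
     + 7 * b³ * 2 ^ 6 + 90 * b⁵ * 2 ^ 5 - 14 * b³ * 2 ^ 5
     - 2 ^ 7 * b³ + 17 * b² * 2 ^ 4 + 28 * b³ * 2 ^ 3
     - 28 * b³ * 2 ^ 2 - 4 * b * 2 ^ 3 + 8 * b³ * 2
     - 57 * b⁴ * 2 ^ 4 + 36 * b⁴ * 2 ^ 3 + 32 * b⁴ * 2 ^ 2
     - 12 * b² * 2 ^ 3 - 48 * b⁴ * 2 - 2 ^ 4 + 16 * b⁴)
  ≡ - 16 * (b - 1) * (b - 1)
E12-numerator-at-2 = solve-∀ ℚ-ring

E21-numerator-at-2 : ∀ b → let b² = b * (b * 1ℚ); b³ = b * b²; b⁴ = b * b³ in
  half * b
  * (5 * 2 ^ 6 * b - 2 * 2 ^ 6 * b² + 52 * 2 ^ 5 * b² - 16 * 2 ^ 5 * b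
     - 2 * 2 ^ 7 * b² + 2 * b⁴ * 2 ^ 8 + 142 * b⁴ * 2 ^ 6
     - 26 * b⁴ * 2 ^ 7 - 426 * b⁴ * 2 ^ 5 - 61 * b³ * 2 ^ 6
     + 100 * b³ * 2 ^ 5 + 14 * 2 ^ 7 * b³ - 2 ^ 8 * b³ - 20 * b * 2 ^ 2
     - 8 * b² * 2 ^ 2 - 16 * b² * 2 - 128 * b² * 2 ^ 4
     - 200 * b³ * 2 ^ 3 + 244 * b³ * 2 ^ 2 + 32 * b * 2 ^ 3
     - 112 * b³ * 2 + 768 * b⁴ * 2 ^ 4 - 852 * b⁴ * 2 ^ 3
     + 568 * b⁴ * 2 ^ 2 + 104 * b² * 2 ^ 3 - 208 * b⁴ * 2 + 8 * 2 ^ 4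
     - 4 * 2 ^ 3 + 16 * b³ + 32 * b⁴ - 2 * 2 ^ 5)
  ≡ 8 * (1 - (b - 1) * (b - 1))
E21-numerator-at-2 = solve-∀ ℚ-ring

module AtTwo {b u : ℚ} (bu≡1 : (b - 1) * u ≡ 1ℚ) where

  mod-bu : ∀ {L R} K → L ≡ R + ((b - 1) * u - 1) * K → L ≡ R
  mod-bu = ≡-mod bu≡1

  D⁻¹-at-2 : inv (D b 2) ≡ - (half * u)
  D⁻¹-at-2 = inv-unique (D b 2) (trans (cong (_* - (half * u)) (D-at-2 b))
                                       (mod-bu 1ℚ (solve (b ∷ u ∷ []) ℚ-ring)))

  W-at-2 : W b 2 ≡ u * u * inv 4
  W-at-2 = cong₂ _*_ (inv-unique ((b * 2 - 1 - b) ^ 2) [b-1]²u²≡1)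
                     (cong inv ([bc-c-2b]²-at-2 b))
    where
    [b-1]²u²≡1 : (b * 2 - 1 - b) ^ 2 * (u * u) ≡ 1ℚ
    [b-1]²u²≡1 = trans (cong (_* (u * u)) ([bc-1-b]²-at-2 b))
                       (mod-bu ((b - 1) * u + 1) (solve (b ∷ u ∷ []) ℚ-ring))

  over-D : ∀ {N n} → N ≡ n → N * inv (D b 2) ≡ n * - (half * u)
  over-D N≡n = cong₂ _*_ N≡n D⁻¹-at-2

  over-W : ∀ {N n} → N ≡ n → N * W b 2 ≡ n * (u * u * inv 4)
  over-W N≡n = cong₂ _*_ N≡n W-at-2

  over-ΔW : ∀ {N n} → N ≡ n → N * inv (Δ b 2) * W b 2 ≡ n * inv 4 * (u * u * inv 4)
  over-ΔW N≡n = cong₂ _*_ (cong₂ _*_ N≡n (cong inv (Δ-at-2 b))) W-at-2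

  P-factor : P b 2 ≈ₚ ((X- 0ℚ) *ₚ (half * (u * u - 1) ∷ u ∷ 1ℚ ∷ []))
  P-factor = begin
    P b 2
      ≈⟨ ∷-congₚ coeff₀ (∷-congₚ coeff₁ (∷-congₚ coeff₂ λ _ → refl)) ⟩
    (- (0ℚ * (half * (u * u - 1))) ∷ half * (u * u - 1) - 0ℚ * u ∷ u - 0ℚ ∷ 1ℚ ∷ [])
      ≈⟨ X-*ₚ-monicQuadratic 0ℚ (half * (u * u - 1)) u ⟨
    (X- 0ℚ) *ₚ (half * (u * u - 1) ∷ u ∷ 1ℚ ∷ [])
      ∎
    where
    open ≈ₚ-Reasoning
    coeff₀ : - E30 b 2 ≡ - (0ℚ * (half * (u * u - 1)))
    coeff₀ = trans (cong -_ (over-ΔW (E30-numerator-at-2 b))) (solve (u ∷ []) ℚ-ring)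
    coeff₁ : E20 b 2 ≡ half * (u * u - 1) - 0ℚ * u
    coeff₁ = trans (over-W (E20-numerator-at-2 b))
                   (mod-bu (- (half * ((b - 1) * u + 1))) (solve (b ∷ u ∷ []) ℚ-ring))
    coeff₂ : - E10 b 2 ≡ u - 0ℚ
    coeff₂ = trans (cong -_ (over-D (E10-numerator-at-2 b))) (solve (u ∷ []) ℚ-ring)

  Q-factor : Q b 2 ≈ₚ ((X- 1ℚ) *ₚ (half * (u * u - 1) ∷ - u ∷ 1ℚ ∷ []))
  Q-factor = begin
    Q b 2
      ≈⟨ ∷-congₚ coeff₀ (∷-congₚ coeff₁ (∷-congₚ coeff₂ λ _ → refl)) ⟩
    (- (1ℚ * (half * (u * u - 1))) ∷ half * (u * u - 1) - 1ℚ * - u ∷ - u - 1ℚ ∷ 1ℚ ∷ [])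
      ≈⟨ X-*ₚ-monicQuadratic 1ℚ (half * (u * u - 1)) (- u) ⟨
    (X- 1ℚ) *ₚ (half * (u * u - 1) ∷ - u ∷ 1ℚ ∷ [])
      ∎
    where
    open ≈ₚ-Reasoning
    coeff₀ : - E03 b 2 ≡ - (1ℚ * (half * (u * u - 1)))
    coeff₀ = trans (cong -_ (over-ΔW (E03-numerator-at-2 b)))
                   (mod-bu (half * ((b - 1) * u + 1)) (solve (b ∷ u ∷ []) ℚ-ring))
    coeff₁ : E02 b 2 ≡ half * (u * u - 1) - 1ℚ * - u
    coeff₁ = trans (over-W (E02-numerator-at-2 b))
                   (mod-bu (u - half * ((b - 1) * u + 1)) (solve (b ∷ u ∷ []) ℚ-ring))
    coeff₂ : - E01 b 2 ≡ - u - 1ℚ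
    coeff₂ = trans (cong -_ (cong (- (b * (2 ^ 2 + 2 - 2 * 2)) *_) D⁻¹-at-2))
                   (mod-bu (- 1ℚ) (solve (b ∷ u ∷ []) ℚ-ring))

  P-reducible : Reducible (P b 2)
  P-reducible =
    X- 0ℚ , (half * (u * u - 1) ∷ u ∷ 1ℚ ∷ []) , (0 , λ ()) , (1 , λ ()) , P-factor

  Q-reducible : Reducible (Q b 2)
  Q-reducible =
    X- 1ℚ , (half * (u * u - 1) ∷ - u ∷ 1ℚ ∷ []) , (0 , λ ()) , (1 , λ ()) , Q-factor

  E11-at-2 : E11 b 2 ≡ - (u + 1)
  E11-at-2 = trans (cong (- (b * (2 ^ 2 + 2 - 4 * 2)) *_) D⁻¹-at-2)
                   (mod-bu (- 1ℚ) (solve (b ∷ u ∷ []) ℚ-ring))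

  E12-at-2 : E12 b 2 ≡ - 1ℚ
  E12-at-2 = trans (over-ΔW (E12-numerator-at-2 b))
                   (mod-bu (- ((b - 1) * u + 1)) (solve (b ∷ u ∷ []) ℚ-ring))

  E21-at-2 : E21 b 2 ≡ half * (u * u - 1)
  E21-at-2 = trans (over-ΔW (E21-numerator-at-2 b))
                   (mod-bu (- (half * ((b - 1) * u + 1))) (solve (b ∷ u ∷ []) ℚ-ring))

  discriminant-square : ∀ {r} → r * r ≡ 2 * (b - 1) * (b - 1) - 1 →
                        (u * r) * (u * r) ≡ 2 - u * u
  discriminant-square {r} r² = begin
    (u * r) * (u * r)                        ≡⟨ solve (u ∷ r ∷ []) ℚ-ring ⟩
    u * u * (r * r)                          ≡⟨ cong (u * u *_) r² ⟩
    u * u * (2 * (b - 1) * (b - 1) - 1)      ≡⟨ mod-bu (2 * ((b - 1) * u + 1))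
                                                   (solve (b ∷ u ∷ []) ℚ-ring) ⟩
    2 - u * u                                ∎
    where open ≡-Reasoning

  module Roots {s : ℚ} (s² : s * s ≡ 2 - u * u) where

    mod-s : ∀ {L R} K → L ≡ R + (s * s - (2 - u * u)) * K → L ≡ R
    mod-s = ≡-mod s²

    P-roots : P b 2 ≈ₚ ((X- 0ℚ) *ₚ ((X- (half * (- u + s))) *ₚ (X- (half * (- u - s)))))
    P-roots = begin
      P b 2
        ≈⟨ P-factor ⟩
      (X- 0ℚ) *ₚ (half * (u * u - 1) ∷ u ∷ 1ℚ ∷ [])
        ≈⟨ *ₚ-congˡ (X- 0ℚ) ((X- (half * (- u + s))) *ₚ (X- (half * (- u - s))))
                    (half * (u * u - 1) ∷ u ∷ 1ℚ ∷ []) splits ⟨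
      (X- 0ℚ) *ₚ ((X- (half * (- u + s))) *ₚ (X- (half * (- u - s))))
        ∎
      where
      open ≈ₚ-Reasoning
      discriminant : s * s ≡ - u * - u - 4 * (half * (u * u - 1))
      discriminant = trans s² (solve (u ∷ []) ℚ-ring)
      splits : ((X- (half * (- u + s))) *ₚ (X- (half * (- u - s))))
               ≈ₚ (half * (u * u - 1) ∷ u ∷ 1ℚ ∷ [])
      splits = begin
        (X- (half * (- u + s))) *ₚ (X- (half * (- u - s)))
          ≈⟨ quadratic-formula (- u) (half * (u * u - 1)) s discriminant ⟩
        (half * (u * u - 1) ∷ - (- u) ∷ 1ℚ ∷ [])
          ≈⟨ ∷-congₚ refl (∷-congₚ (⁻¹-involutive u) λ _ → refl) ⟩
        (half * (u * u - 1) ∷ u ∷ 1ℚ ∷ [])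
          ∎

    Q-roots : Q b 2 ≈ₚ ((X- 1ℚ) *ₚ ((X- (half * (u + s))) *ₚ (X- (half * (u - s)))))
    Q-roots = begin
      Q b 2
        ≈⟨ Q-factor ⟩
      (X- 1ℚ) *ₚ (half * (u * u - 1) ∷ - u ∷ 1ℚ ∷ [])
        ≈⟨ *ₚ-congˡ (X- 1ℚ) ((X- (half * (u + s))) *ₚ (X- (half * (u - s))))
                    (half * (u * u - 1) ∷ - u ∷ 1ℚ ∷ [])
                    (quadratic-formula u (half * (u * u - 1)) s discriminant) ⟨
      (X- 1ℚ) *ₚ ((X- (half * (u + s))) *ₚ (X- (half * (u - s))))
        ∎
      where
      open ≈ₚ-Reasoning
      discriminant : s * s ≡ u * u - 4 * (half * (u * u - 1))
      discriminant = trans s² (solve (u ∷ []) ℚ-ring)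

    auxiliary : Auxiliary b 2 0ℚ (half * (- u + s)) (half * (- u - s))
                              1ℚ (half * (u + s)) (half * (u - s))
    auxiliary = trans aux₂₁ (sym E21-at-2) , trans aux₁₁ (sym E11-at-2)
              , trans aux₁₂ (sym E12-at-2)
      where
      aux₂₁ : 0ℚ * (half * (- u + s)) * (half * (u - s))
              + half * (- u + s) * (half * (- u - s)) * 1ℚ
              + half * (- u - s) * 0ℚ * (half * (u + s))
              ≡ half * (u * u - 1)
      aux₂₁ = mod-s (- (half * half)) (solve (u ∷ s ∷ []) ℚ-ring)
      aux₁₁ : 0ℚ * (half * (u + s)) + 1ℚ * (half * (- u + s))
              + half * (- u + s) * (half * (u - s)) + half * (u + s) * (half * (- u - s))
              + half * (- u - s) * 1ℚ + half * (u - s) * 0ℚ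
              ≡ - (u + 1)
      aux₁₁ = mod-s (- half) (solve (u ∷ s ∷ []) ℚ-ring)
      aux₁₂ : 0ℚ * (half * (u + s)) * (half * (u - s))
              + half * (- u + s) * (half * (u - s)) * 1ℚ
              + half * (- u - s) * 1ℚ * (half * (u + s))
              ≡ - 1ℚ
      aux₁₂ = mod-s (- half) (solve (u ∷ s ∷ []) ℚ-ring)

conic-parametrisation : ∀ t w → let x = t + 2 in (x * (x * 1ℚ) - 2) * w ≡ 1ℚ →
  (t * t - 2) * w * ((t * t - 2) * w) ≡ 2 * (2 * t * w - 1) * (2 * t * w - 1) - 1
conic-parametrisation t w dw≡1 =
  ≡-mod dw≡1 (w * ((t + 2) * (t + 2) - 2) + 1 - 8 * t * w)
        (solve (t ∷ w ∷ []) ℚ-ring)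

-- (t + 2)² = 2 has no rational solution, but instead of proving √2 irrational
-- the case is handled through the junk value inv 0 = 0: then b = 0 and r = 1.
conic-point : ∀ {b} t → b ≡ 2 * t * inv ((t + 2) ^ 2 - 2) →
              ∃ λ r → r * r ≡ 2 * (b - 1) * (b - 1) - 1
conic-point {b} t b≡ = by-cases ((t + 2) ^ 2 - 2 ≟ 0ℚ)
  where
  on-conic : ∀ {b′} r → r * r ≡ 2 * (b′ - 1) * (b′ - 1) - 1 → b ≡ b′ →
             ∃ λ r → r * r ≡ 2 * (b - 1) * (b - 1) - 1
  on-conic r r² refl = r , r²
  by-cases : Dec ((t + 2) ^ 2 - 2 ≡ 0ℚ) → ∃ λ r → r * r ≡ 2 * (b - 1) * (b - 1) - 1
  by-cases (yes denominator≡0) =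
    on-conic 1ℚ refl
      (trans b≡ (trans (cong (2 * t *_) (inv-0 denominator≡0)) (*-zeroʳ (2 * t))))
  by-cases (no denominator≢0) =
    on-conic ((t * t - 2) * w) (conic-parametrisation t w (inv-inverseʳ denominator≢0)) b≡
    where
    w : ℚ
    w = inv ((t + 2) ^ 2 - 2)

theorem5p1 : (b : ℚ) → b ≢ 1ℚ →
    Reducible (P b 2) × Reducible (Q b 2)
  × ((t : ℚ) → b ≡ 2 * t * inv ((t + 2) ^ 2 - 2) →
      Σ ℚ λ x₁ → Σ ℚ λ x₂ → Σ ℚ λ x₃ → Σ ℚ λ d₁ → Σ ℚ λ d₂ → Σ ℚ λ d₃ →
          (P b 2 ≈ₚ ((X- x₁) *ₚ ((X- x₂) *ₚ (X- x₃))))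
        × (Q b 2 ≈ₚ ((X- d₁) *ₚ ((X- d₂) *ₚ (X- d₃))))
        × Auxiliary b 2 x₁ x₂ x₃ d₁ d₂ d₃
        × ¬ ((0ℚ < x₁) × (0ℚ < x₂) × (0ℚ < x₃)
             × (0ℚ < d₁) × (0ℚ < d₂) × (0ℚ < d₃)))
theorem5p1 b b≢1 =
  P-reducible , Q-reducible ,
  λ t b≡ → let (r , r²) = conic-point t b≡
               s = u * r
               open Roots {s} (discriminant-square {r} r²)
           in 0ℚ , half * (- u + s) , half * (- u - s) , 1ℚ , half * (u + s) , half * (u - s) ,
              P-roots , Q-roots , auxiliary , λ (0<0 , _) → <-irrefl refl 0<0
  where
  u : ℚ
  u = inv (b - 1)
  open AtTwo {b} {u} (inv-inverseʳ {b - 1} (b≢1 ∘ x∙y⁻¹≈ε⇒x≈y b 1ℚ))
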